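{- For every positive integer $n$, the graph $\Phi(\mathbb H(\mathbb Z_{2^n}))$ is not complete.
   Context: $\mathbb H(\mathbb Z_{2^n})$ is the ring of Hamilton quaternions over $\mathbb Z_{2^n}$. Its elements are $a_1+a_2i+a_3j+a_4k$ with $a_i\in\mathbb Z_{2^n}$, written $(a_1,a_2,a_3,a_4)$. Addition is coordinatewise, and multiplication is determined by distributivity, scalars commuting with $i,j,k$, and $i^2=j^2=k^2=-1$, $ij=-ji=k$, $jk=-kj=i$, $ki=-ik=j$. For a ring $R$ with unity, the non-zero divisor graph $\Phi(R)$ is the simple graph with vertex set $R\setminus\{0,1,-1\}$ in which two distinct vertices $x,y$ are adjacent if and only if $xy\neq0$ or $yx\neq0$. -}

module Defs where

open import Data.Nat using (ℕ; suc; NonZero; _^_) renaming (_+_ to _+ℕ_; _*_ to _*ℕ_; _∸_ to _∸ℕ_)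
open import Data.Nat.DivMod using (_mod_)
open import Data.Nat.Properties using (m^n≢0)
open import Data.Fin using (Fin; toℕ)
open import Data.Product using (_×_; Σ; ∃; ∃-syntax; _,_)
open import Data.Sum using (_⊎_)
open import Relation.Binary.PropositionalEquality using (_≡_)
open import Relation.Nullary using (¬_)

module ZMod (m : ℕ) .{{nz : NonZero m}} where

  Z : Set
  Z = Fin m

  infixl 6 _+_ _-_
  infixl 7 _*_

  _+_ : Z → Z → Z
  a + b = (toℕ a +ℕ toℕ b) mod m

  _*_ : Z → Z → Z
  a * b = (toℕ a *ℕ toℕ b) mod m

  -_ : Z → Z
  - a = (m ∸ℕ toℕ a) mod m

  _-_ : Z → Z → Z
  a - b = a + (- b)

  0ᶻ 1ᶻ : Z
  0ᶻ = 0 mod m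
  1ᶻ = 1 mod m

  -- Hamilton quaternions a₁ + a₂ i + a₃ j + a₄ k over ℤ_m

  record ℍ : Set where
    constructor quat
    field
      a₁ a₂ a₃ a₄ : Z

  open ℍ public

  -- Hamilton product (from i²=j²=k²=-1, ij=-ji=k, jk=-kj=i, ki=-ik=j)
  _·_ : ℍ → ℍ → ℍ
  quat a b c d · quat e f g h = quat
    (a * e - b * f - c * g - d * h)
    (a * f + b * e + c * h - d * g)
    (a * g - b * h + c * e + d * f)
    (a * h + b * g - c * f + d * e)

  0ℍ 1ℍ -1ℍ : ℍ
  0ℍ  = quat 0ᶻ 0ᶻ 0ᶻ 0ᶻ
  1ℍ  = quat 1ᶻ 0ᶻ 0ᶻ 0ᶻ
  -1ℍ = quat (- 1ᶻ) 0ᶻ 0ᶻ 0ᶻ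

  IsVertex : ℍ → Set
  IsVertex x = ¬ x ≡ 0ℍ × ¬ x ≡ 1ℍ × ¬ x ≡ -1ℍ

  Adjacent : ℍ → ℍ → Set
  Adjacent x y = ¬ x ≡ y × (¬ (x · y) ≡ 0ℍ ⊎ ¬ (y · x) ≡ 0ℍ)

  IsComplete : Set
  IsComplete = ∀ x y → IsVertex x → IsVertex y → ¬ x ≡ y → Adjacent x y

Φ-ℍℤ2^n-complete : ℕ → Set
Φ-ℍℤ2^n-complete n = ZMod.IsComplete (2 ^ n) {{m^n≢0 2 n}}

-- For m = 2h (here 2^(n+1) = 2 · 2^n) the element h of ℤ_m is non-zero with h + h = 0.  In ℍ(ℤ) one computes
-- (1 + i)(1 + i + j + k) = 2(i + k) and (1 + i + j + k)(1 + i) = 2(i + j), so the two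
-- distinct vertices h(1 + i) and 1 + i + j + k annihilate each other in both orders.
module Submission where

open import Defs
open import Data.Nat as ℕ using (ℕ; suc; NonZero; _%_; _∸_; _^_)
  renaming (_+_ to _+ℕ_; _*_ to _*ℕ_)
import Data.Nat.Properties as ℕ
open import Data.Nat.DivMod using (_mod_; m%n<n; n%n≡0; m%n%n≡m%n; m<n⇒m%n≡m; %-distribˡ-+; %-distribˡ-*)
open import Data.Fin using (toℕ)
open import Data.Fin.Properties using (toℕ-fromℕ<; toℕ-injective; toℕ<n)
open import Data.Product using (_,_; proj₂)
open import Data.Sum using ([_,_])
open import Function using (_∘_)
open import Relation.Binary.PropositionalEquality using (_≡_; refl; sym; trans; cong; module ≡-Reasoning)
open import Relation.Nullary using (¬_)

module ZModProperties (m : ℕ) .{{_ : NonZero m}} where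

  open ZMod m
  open ≡-Reasoning

  toℕ-mod : ∀ k → toℕ (k mod m) ≡ k % m
  toℕ-mod k = toℕ-fromℕ< (m%n<n k m)

  mod-cong : ∀ {k l} → k % m ≡ l % m → k mod m ≡ l mod m
  mod-cong {k} {l} eq = toℕ-injective (trans (toℕ-mod k) (trans eq (sym (toℕ-mod l))))

  mod-toℕ : ∀ a → toℕ a mod m ≡ a
  mod-toℕ a = toℕ-injective (trans (toℕ-mod (toℕ a)) (m<n⇒m%n≡m (toℕ<n a)))

  0%m≡0 : 0 % m ≡ 0
  0%m≡0 = m<n⇒m%n≡m (ℕ.>-nonZero⁻¹ m)

  toℕ-0ᶻ : toℕ 0ᶻ ≡ 0
  toℕ-0ᶻ = trans (toℕ-mod 0) 0%m≡0

  m-mod-m≡0ᶻ : m mod m ≡ 0ᶻ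
  m-mod-m≡0ᶻ = mod-cong (trans (n%n≡0 m) (sym 0%m≡0))

  [k+l%m]%m≡[k+l]%m : ∀ k l → (k +ℕ l % m) % m ≡ (k +ℕ l) % m
  [k+l%m]%m≡[k+l]%m k l = begin
    (k +ℕ l % m) % m           ≡⟨ %-distribˡ-+ k (l % m) m ⟩
    (k % m +ℕ l % m % m) % m   ≡⟨ cong (λ r → (k % m +ℕ r) % m) (m%n%n≡m%n l m) ⟩
    (k % m +ℕ l % m) % m       ≡⟨ %-distribˡ-+ k l m ⟨
    (k +ℕ l) % m               ∎

  [k*[l%m]]%m≡[k*l]%m : ∀ k l → (k *ℕ (l % m)) % m ≡ (k *ℕ l) % m
  [k*[l%m]]%m≡[k*l]%m k l = begin
    (k *ℕ (l % m)) % m             ≡⟨ %-distribˡ-* k (l % m) m ⟩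
    (k % m *ℕ (l % m % m)) % m     ≡⟨ cong (λ r → (k % m *ℕ r) % m) (m%n%n≡m%n l m) ⟩
    (k % m *ℕ (l % m)) % m         ≡⟨ %-distribˡ-* k l m ⟨
    (k *ℕ l) % m               ∎

  +-comm : ∀ a b → a + b ≡ b + a
  +-comm a b = cong (_mod m) (ℕ.+-comm (toℕ a) (toℕ b))

  *-comm : ∀ a b → a * b ≡ b * a
  *-comm a b = cong (_mod m) (ℕ.*-comm (toℕ a) (toℕ b))

  +-identityʳ : ∀ a → a + 0ᶻ ≡ a
  +-identityʳ a = begin
    (toℕ a +ℕ toℕ 0ᶻ) mod m   ≡⟨ cong (λ r → (toℕ a +ℕ r) mod m) toℕ-0ᶻ ⟩
    (toℕ a +ℕ 0) mod m        ≡⟨ cong (_mod m) (ℕ.+-identityʳ (toℕ a)) ⟩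
    toℕ a mod m               ≡⟨ mod-toℕ a ⟩
    a                         ∎

  +-identityˡ : ∀ a → 0ᶻ + a ≡ a
  +-identityˡ a = trans (+-comm 0ᶻ a) (+-identityʳ a)

  *-identityʳ : ∀ a → a * 1ᶻ ≡ a
  *-identityʳ a = begin
    (toℕ a *ℕ toℕ 1ᶻ) mod m   ≡⟨ mod-cong (trans (cong (λ r → (toℕ a *ℕ r) % m) (toℕ-mod 1))
                                                 ([k*[l%m]]%m≡[k*l]%m (toℕ a) 1)) ⟩
    (toℕ a *ℕ 1) mod m        ≡⟨ cong (_mod m) (ℕ.*-identityʳ (toℕ a)) ⟩
    toℕ a mod m               ≡⟨ mod-toℕ a ⟩
    a                         ∎

  *-identityˡ : ∀ a → 1ᶻ * a ≡ a
  *-identityˡ a = trans (*-comm 1ᶻ a) (*-identityʳ a)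

  *-zeroˡ : ∀ a → 0ᶻ * a ≡ 0ᶻ
  *-zeroˡ a = cong (λ r → (r *ℕ toℕ a) mod m) toℕ-0ᶻ

  *-zeroʳ : ∀ a → a * 0ᶻ ≡ 0ᶻ
  *-zeroʳ a = trans (*-comm a 0ᶻ) (*-zeroˡ a)

  -‿inverseʳ : ∀ a → a - a ≡ 0ᶻ
  -‿inverseʳ a = begin
    (toℕ a +ℕ toℕ (- a)) mod m   ≡⟨ mod-cong (trans (cong (λ r → (toℕ a +ℕ r) % m) (toℕ-mod (m ∸ toℕ a)))
                                                    ([k+l%m]%m≡[k+l]%m (toℕ a) (m ∸ toℕ a))) ⟩
    (toℕ a +ℕ (m ∸ toℕ a)) mod m ≡⟨ cong (_mod m) (ℕ.m+[n∸m]≡n (ℕ.<⇒≤ (toℕ<n a))) ⟩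
    m mod m                      ≡⟨ m-mod-m≡0ᶻ ⟩
    0ᶻ                           ∎

  -‿inverseˡ : ∀ a → - a + a ≡ 0ᶻ
  -‿inverseˡ a = trans (+-comm (- a) a) (-‿inverseʳ a)

  -0ᶻ≡0ᶻ : - 0ᶻ ≡ 0ᶻ
  -0ᶻ≡0ᶻ = trans (cong (λ r → (m ∸ r) mod m) toℕ-0ᶻ) m-mod-m≡0ᶻ

  -‿identityʳ : ∀ a → a - 0ᶻ ≡ a
  -‿identityʳ a = trans (cong (a +_) -0ᶻ≡0ᶻ) (+-identityʳ a)

  z≢0ᶻ⇒1ᶻ≢0ᶻ : ∀ {z} → ¬ z ≡ 0ᶻ → ¬ 1ᶻ ≡ 0ᶻ
  z≢0ᶻ⇒1ᶻ≢0ᶻ {z} z≢0ᶻ 1ᶻ≡0ᶻ = z≢0ᶻ (begin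
    z          ≡⟨ *-identityʳ z ⟨
    z * 1ᶻ     ≡⟨ cong (z *_) 1ᶻ≡0ᶻ ⟩
    z * 0ᶻ     ≡⟨ *-zeroʳ z ⟩
    0ᶻ         ∎)

module QuaternionZeroDivisors (m : ℕ) .{{_ : NonZero m}} where

  open ZMod m
  open ZModProperties m

  quat≡0ℍ : ∀ {a b c d} → a ≡ 0ᶻ → b ≡ 0ᶻ → c ≡ 0ᶻ → d ≡ 0ᶻ → quat a b c d ≡ 0ℍ
  quat≡0ℍ refl refl refl refl = refl

  scale-1+i : Z → ℍ
  scale-1+i z = quat z z 0ᶻ 0ᶻ

  1+i+j+k : ℍ
  1+i+j+k = quat 1ᶻ 1ᶻ 1ᶻ 1ᶻ

  module _ (z : Z) (z+z≡0ᶻ : z + z ≡ 0ᶻ) where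

    scale-1+i·1+i+j+k≡0ℍ : scale-1+i z · 1+i+j+k ≡ 0ℍ
    scale-1+i·1+i+j+k≡0ℍ = quat≡0ℍ real i-part j-part k-part
      where
      real : z * 1ᶻ - z * 1ᶻ - 0ᶻ * 1ᶻ - 0ᶻ * 1ᶻ ≡ 0ᶻ
      real rewrite *-identityʳ z | *-zeroˡ 1ᶻ | -‿inverseʳ z | -‿identityʳ 0ᶻ | -‿identityʳ 0ᶻ = refl
      i-part : z * 1ᶻ + z * 1ᶻ + 0ᶻ * 1ᶻ - 0ᶻ * 1ᶻ ≡ 0ᶻ
      i-part rewrite *-identityʳ z | *-zeroˡ 1ᶻ | z+z≡0ᶻ | +-identityʳ 0ᶻ | -‿identityʳ 0ᶻ = refl
      j-part : z * 1ᶻ - z * 1ᶻ + 0ᶻ * 1ᶻ + 0ᶻ * 1ᶻ ≡ 0ᶻ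
      j-part rewrite *-identityʳ z | *-zeroˡ 1ᶻ | -‿inverseʳ z | +-identityʳ 0ᶻ | +-identityʳ 0ᶻ = refl
      k-part : z * 1ᶻ + z * 1ᶻ - 0ᶻ * 1ᶻ + 0ᶻ * 1ᶻ ≡ 0ᶻ
      k-part rewrite *-identityʳ z | *-zeroˡ 1ᶻ | z+z≡0ᶻ | -‿identityʳ 0ᶻ | +-identityʳ 0ᶻ = refl

    1+i+j+k·scale-1+i≡0ℍ : 1+i+j+k · scale-1+i z ≡ 0ℍ
    1+i+j+k·scale-1+i≡0ℍ = quat≡0ℍ real i-part j-part k-part
      where
      real : 1ᶻ * z - 1ᶻ * z - 1ᶻ * 0ᶻ - 1ᶻ * 0ᶻ ≡ 0ᶻ
      real rewrite *-identityˡ z | *-identityˡ 0ᶻ | -‿inverseʳ z | -‿identityʳ 0ᶻ | -‿identityʳ 0ᶻ = refl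
      i-part : 1ᶻ * z + 1ᶻ * z + 1ᶻ * 0ᶻ - 1ᶻ * 0ᶻ ≡ 0ᶻ
      i-part rewrite *-identityˡ z | *-identityˡ 0ᶻ | z+z≡0ᶻ | +-identityʳ 0ᶻ | -‿identityʳ 0ᶻ = refl
      j-part : 1ᶻ * 0ᶻ - 1ᶻ * 0ᶻ + 1ᶻ * z + 1ᶻ * z ≡ 0ᶻ
      j-part rewrite *-identityˡ z | *-identityˡ 0ᶻ | -‿identityʳ 0ᶻ | +-identityˡ z | z+z≡0ᶻ = refl
      k-part : 1ᶻ * 0ᶻ + 1ᶻ * 0ᶻ - 1ᶻ * z + 1ᶻ * z ≡ 0ᶻ
      k-part rewrite *-identityˡ z | *-identityˡ 0ᶻ | +-identityʳ 0ᶻ =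
        trans (cong (_+ z) (+-identityˡ (- z))) (-‿inverseˡ z)

  2-torsion⇒¬IsComplete : (z : Z) → ¬ z ≡ 0ᶻ → z + z ≡ 0ᶻ → ¬ IsComplete
  2-torsion⇒¬IsComplete z z≢0ᶻ z+z≡0ᶻ complete =
    [ (λ xy≢0ℍ → xy≢0ℍ (scale-1+i·1+i+j+k≡0ℍ z z+z≡0ᶻ))
    , (λ yx≢0ℍ → yx≢0ℍ (1+i+j+k·scale-1+i≡0ℍ z z+z≡0ᶻ)) ]
    (proj₂ (complete (scale-1+i z) 1+i+j+k x-vertex y-vertex x≢y))
    where
    1ᶻ≢0ᶻ : ¬ 1ᶻ ≡ 0ᶻ
    1ᶻ≢0ᶻ = z≢0ᶻ⇒1ᶻ≢0ᶻ z≢0ᶻ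
    x-vertex : IsVertex (scale-1+i z)
    x-vertex = z≢0ᶻ ∘ cong a₂ , z≢0ᶻ ∘ cong a₂ , z≢0ᶻ ∘ cong a₂
    y-vertex : IsVertex 1+i+j+k
    y-vertex = 1ᶻ≢0ᶻ ∘ cong a₂ , 1ᶻ≢0ᶻ ∘ cong a₂ , 1ᶻ≢0ᶻ ∘ cong a₂
    x≢y : ¬ scale-1+i z ≡ 1+i+j+k
    x≢y = 1ᶻ≢0ᶻ ∘ sym ∘ cong a₃

module _ (h : ℕ) .{{_ : NonZero h}} where

  private instance
    2h≢0 : NonZero (2 *ℕ h)
    2h≢0 = ℕ.m*n≢0 2 h

  open ZMod (2 *ℕ h)
  open ZModProperties (2 *ℕ h)
  open QuaternionZeroDivisors (2 *ℕ h)

  half : Z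
  half = h mod (2 *ℕ h)

  toℕ-half : toℕ half ≡ h
  toℕ-half = trans (toℕ-mod h) (m<n⇒m%n≡m h<2h)
    where
    h<2h : h ℕ.< 2 *ℕ h
    h<2h = ℕ.m<m+n h (ℕ.≤-trans (ℕ.>-nonZero⁻¹ h) (ℕ.m≤m+n h 0))

  half≢0ᶻ : ¬ half ≡ 0ᶻ
  half≢0ᶻ half≡0ᶻ = ℕ.≢-nonZero⁻¹ h (trans (sym toℕ-half) (trans (cong toℕ half≡0ᶻ) toℕ-0ᶻ))

  half+half≡0ᶻ : half + half ≡ 0ᶻ
  half+half≡0ᶻ = begin
    (toℕ half +ℕ toℕ half) mod (2 *ℕ h)   ≡⟨ cong (λ r → (r +ℕ r) mod (2 *ℕ h)) toℕ-half ⟩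
    (h +ℕ h) mod (2 *ℕ h)                 ≡⟨ cong (λ r → (h +ℕ r) mod (2 *ℕ h)) (ℕ.+-identityʳ h) ⟨
    (2 *ℕ h) mod (2 *ℕ h)                 ≡⟨ m-mod-m≡0ᶻ ⟩
    0ᶻ                                    ∎
    where open ≡-Reasoning

  ¬IsComplete-2*h : ¬ IsComplete
  ¬IsComplete-2*h = 2-torsion⇒¬IsComplete half half≢0ᶻ half+half≡0ᶻ

corollary4p1 : (n : ℕ) → ¬ Φ-ℍℤ2^n-complete (suc n)
corollary4p1 n = ¬IsComplete-2*h (2 ^ n) {{ℕ.m^n≢0 2 n}}
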